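{- Let $m,r\ge 1$ be integers with $m\ge\binom{2r-1}{r}$, and let the $r$-expansion of $m$ be $m=\binom{a_{r_1}}{r_1}+\dots+\binom{a_{r_s}}{r_s}$. Fix $t\in[r]$, set $r_{s+1}=-s-1$, and let $i$ be the unique integer such that $r_i+(i-1)\ge t>r_{i+1}+i$. Suppose that $i\le s-1$ and define \[ m'=\binom{a_{r_1}}{t}+\binom{a_{r_2}}{t-1}+\dots+\binom{a_{r_i}}{t-(i-1)}+\binom{a_{r_{i+1}}}{r_{i+1}}+\dots+\binom{a_{r_s}}{r_s}. \] Then this expression is the $t$-expansion of $m'$.
   Context: For integers $m,r\ge1$ with $m\ge\binom{2r-1}{r}$, the $r$-expansion of $m$ is defined recursively: set $r_1=r$ and let $a_{r_1}$ be the largest integer $j$ with $\binom{j}{r_1}\le m$; put $m''=m-\binom{a_{r_1}}{r_1}$. If $m''=0$ the expansion is $m=\binom{a_{r_1}}{r_1}$. Otherwise let $r'$ be the largest integer $j\le r-1$ with $\binom{2j-1}{j}\le m''$, and the $r$-expansion of $m$ is $\binom{a_{r_1}}{r_1}$ followed by the terms of the $r'$-expansion of $m''$. The terms are written $\binom{a_{r_1}}{r_1}+\dots+\binom{a_{r_s}}{r_s}$ (with $r=r_1>\dots>r_s\ge1$). -}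

module Defs where

open import Data.Nat using (ℕ; zero; suc; _+_; _*_; _∸_; _≤_; _<_)
open import Data.Nat.Combinatorics using (_C_)
open import Data.Product using (_×_; _,_)
open import Data.List using (List; []; _∷_; map)
open import Data.Nat.ListAction using (sum)
open import Relation.Binary.PropositionalEquality using (_≡_)

-- A term  binom(a, k)  of an expansion is stored as the pair (a , k).
Term : Set
Term = ℕ × ℕ

value : List Term → ℕ
value xs = sum (map (λ { (a , k) → a C k }) xs)

LargestTop : ℕ → ℕ → ℕ → Set
LargestTop r m a = (a C r ≤ m) × (∀ j → j C r ≤ m → j ≤ a)

LargestLevel : ℕ → ℕ → ℕ → Set
LargestLevel k n r' =
  (r' ≤ k) × ((2 * r' ∸ 1) C r' ≤ n) × (∀ j → j ≤ k → (2 * j ∸ 1) C j ≤ n → j ≤ r')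

data Expansion : ℕ → ℕ → List Term → Set where
  single : ∀ {r m a} → 1 ≤ r → (2 * r ∸ 1) C r ≤ m → LargestTop r m a →
           m ∸ a C r ≡ 0 → Expansion r m ((a , r) ∷ [])
  more   : ∀ {r m a r' L} → 1 ≤ r → (2 * r ∸ 1) C r ≤ m → LargestTop r m a →
           0 < m ∸ a C r → LargestLevel (r ∸ 1) (m ∸ a C r) r' →
           Expansion r' (m ∸ a C r) L → Expansion r m ((a , r) ∷ L)

relabel : ℕ → List Term → List Term
relabel t [] = []
relabel t ((a , _) ∷ xs) = (a , t) ∷ relabel (t ∸ 1) xs

-- Relabelling keeps every top a_j and only lowers levels, so it suffices to
-- re-check the greedy choices from the last relabelled term backwards.  By
-- Pascal's rule, putting (c, t) in front of an expansion of n whose level is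
-- the largest one ≤ t-1 gives the t-expansion of binom(c,t) + n as soon as 2t-1 ≤ c and
-- n < binom(c, t-1).  Both hold because the tops of an expansion strictly
-- decrease (so n < binom(a'+1, t-1) ≤ binom(c, t-1) for the next top a'),
-- and, for the last relabelled term, whose remainder keeps its level σ < t,
-- because binom(a, σ) ≤ binom(a, t-1) on the lower half of the row a.
module Submission where

open import Defs

open import Data.Nat
open import Data.Nat.Properties
open import Data.Nat.Combinatorics
  using (_C_; nCk+nC[k+1]≡[n+1]C[k+1]; k>n⇒nCk≡0; nC1≡n; nCk≡nC[n∸k])
open import Data.Nat.Tactic.RingSolver using (solve-∀)
open import Data.Product using (_×_; _,_; proj₁; proj₂; ∃-syntax)
open import Data.Sum using (inj₁; inj₂)
open import Data.List using (List; []; _∷_; _++_; length)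
open import Data.List.Properties using (++-conicalʳ)
open import Function using (case_of_)
open import Relation.Binary.PropositionalEquality
open import Relation.Nullary using (contradiction)

nCk≤[1+n]Ck : ∀ n k → n C k ≤ suc n C k
nCk≤[1+n]Ck n zero = ≤-refl
nCk≤[1+n]Ck n (suc k) =
  subst (n C suc k ≤_) (nCk+nC[k+1]≡[n+1]C[k+1] n k) (m≤n+m (n C suc k) (n C k))

C-monoˡ-≤ : ∀ k {n n'} → n ≤ n' → n C k ≤ n' C k
C-monoˡ-≤ k n≤n' = go (≤⇒≤′ n≤n')
  where
  go : ∀ {n n'} → n ≤′ n' → n C k ≤ n' C k
  go ≤′-refl = ≤-refl
  go (≤′-step {n'} n≤n') = ≤-trans (go n≤n') (nCk≤[1+n]Ck n' k)

nCk<n'Ck⇒n<n' : ∀ k {n n'} → n C k < n' C k → n < n'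
nCk<n'Ck⇒n<n' k lt = ≰⇒> λ n'≤n → <⇒≱ lt (C-monoˡ-≤ k n'≤n)

k≤n⇒nCk>0 : ∀ {n k} → k ≤ n → 0 < n C k
k≤n⇒nCk>0 {n} {zero} _ = ≤-refl
k≤n⇒nCk>0 {suc n} {suc k} (s≤s k≤n) =
  subst (0 <_) (nCk+nC[k+1]≡[n+1]C[k+1] n k) (≤-trans (k≤n⇒nCk>0 k≤n) (m≤m+n _ _))

-- The absorption identity (k+1) binom(n,k+1) = (n-k) binom(n,k), without subtraction.
[1+k]*nC[1+k]+k*nCk≡n*nCk : ∀ n k → suc k * (n C suc k) + k * (n C k) ≡ n * (n C k)
[1+k]*nC[1+k]+k*nCk≡n*nCk zero zero = refl
[1+k]*nC[1+k]+k*nCk≡n*nCk zero (suc k)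
  rewrite k>n⇒nCk≡0 {0} {suc (suc k)} z<s | k>n⇒nCk≡0 {0} {suc k} z<s | *-zeroʳ k = refl
[1+k]*nC[1+k]+k*nCk≡n*nCk (suc n) zero rewrite nC1≡n (suc n) =
  trans (+-identityʳ _) (trans (+-identityʳ _) (sym (*-identityʳ (suc n))))
[1+k]*nC[1+k]+k*nCk≡n*nCk (suc n) (suc k)
  rewrite sym (nCk+nC[k+1]≡[n+1]C[k+1] n (suc k)) | sym (nCk+nC[k+1]≡[n+1]C[k+1] n k) = begin
    suc (suc k) * (y + z) + suc k * (x + y)
      ≡⟨ regroup x y z k ⟩
    (suc (suc k) * z + suc k * y) + (suc k * y + k * x) + (y + x)
      ≡⟨ cong₂ (λ u v → u + v + (y + x))
               ([1+k]*nC[1+k]+k*nCk≡n*nCk n (suc k)) ([1+k]*nC[1+k]+k*nCk≡n*nCk n k) ⟩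
    n * y + n * x + (y + x)
      ≡⟨ collect x y n ⟩
    suc n * (x + y) ∎
  where
  open ≡-Reasoning
  x = n C k
  y = n C suc k
  z = n C suc (suc k)
  regroup : ∀ x y z k → suc (suc k) * (y + z) + suc k * (x + y)
                      ≡ (suc (suc k) * z + suc k * y) + (suc k * y + k * x) + (y + x)
  regroup = solve-∀
  collect : ∀ x y n → n * y + n * x + (y + x) ≡ suc n * (x + y)
  collect = solve-∀

nCk≤nC[1+k] : ∀ n k → suc (k + k) ≤ n → n C k ≤ n C suc k
nCk≤nC[1+k] n k 2k<n = *-cancelˡ-≤ (suc k) (+-cancelʳ-≤ (k * x) (suc k * x) (suc k * y) (begin
  suc k * x + k * x      ≡⟨ *-distribʳ-+ x (suc k) k ⟨
  (suc k + k) * x        ≤⟨ *-monoˡ-≤ x 2k<n ⟩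
  n * x                  ≡⟨ [1+k]*nC[1+k]+k*nCk≡n*nCk n k ⟨
  suc k * y + k * x      ∎))
  where
  x = n C k
  y = n C suc k
  open ≤-Reasoning

C-monoʳ-≤ : ∀ n {j k} → j ≤ k → k + k ≤ suc n → n C j ≤ n C k
C-monoʳ-≤ n j≤k = go (≤⇒≤′ j≤k)
  where
  go : ∀ {j k} → j ≤′ k → k + k ≤ suc n → n C j ≤ n C k
  go ≤′-refl _ = ≤-refl
  go (≤′-step {k} j≤k) 2k+2≤n+1 = ≤-trans
    (go j≤k (≤-trans (+-mono-≤ (n≤1+n k) (n≤1+n k)) 2k+2≤n+1))
    (nCk≤nC[1+k] n k (≤-pred (subst (_≤ suc n) (+-suc (suc k) k) 2k+2≤n+1)))

[1+2n]C[1+n]≡[1+2n]Cn : ∀ n → suc (n + n) C suc n ≡ suc (n + n) C n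
[1+2n]C[1+n]≡[1+2n]Cn n =
  trans (nCk≡nC[n∸k] (s≤s (m≤n+m n n))) (cong (suc (n + n) C_) (m+n∸n≡m n n))

2*[1+n]∸1≡1+[n+n] : ∀ n → 2 * suc n ∸ 1 ≡ suc (n + n)
2*[1+n]∸1≡1+[n+n] n = trans (cong (n +_) (+-identityʳ (suc n))) (+-suc n n)

0<[2r∸1]Cr : ∀ {r} → 1 ≤ r → 0 < (2 * r ∸ 1) C r
0<[2r∸1]Cr {suc r} _ =
  k≤n⇒nCk>0 (subst (suc r ≤_) (sym (2*[1+n]∸1≡1+[n+n] r)) (s≤s (m≤n+m r r)))

largestTop-upper : ∀ r {m x} → LargestTop r m x → m < suc x C r
largestTop-upper _ {x = x} (_ , maximal) = ≰⇒> λ le → 1+n≰n (maximal (suc x) le)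

largestTop-remainder< : ∀ r {m x} → LargestTop (suc r) m x → m ∸ x C suc r < x C r
largestTop-remainder< r {m} {x} top@(xCr≤m , _) =
  +-cancelʳ-< (x C suc r) (m ∸ x C suc r) (x C r)
    (subst₂ _<_ (sym (m∸n+n≡m xCr≤m)) (sym (nCk+nC[k+1]≡[n+1]C[k+1] x r)) (largestTop-upper (suc r) top))

largestLevel-upper : ∀ {k n r'} → LargestLevel k n r' → r' < k → n < suc (r' + r') C r'
largestLevel-upper {n = n} {r'} (_ , _ , maximal) r'<k =
  subst (n <_) (trans (cong (_C suc r') (2*[1+n]∸1≡1+[n+n] r')) ([1+2n]C[1+n]≡[1+2n]Cn r'))
    (≰⇒> λ le → 1+n≰n (maximal (suc r') r'<k le))

expansion-value : ∀ {r m L} → Expansion r m L → value L ≡ m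
expansion-value (single {r} {m} {a} _ _ (aCr≤m , _) m∸aCr≡0) =
  trans (+-identityʳ (a C r)) (≤-antisym aCr≤m (m∸n≡0⇒m≤n m∸aCr≡0))
expansion-value (more {r} {m} {a} _ _ (aCr≤m , _) _ _ rest) =
  trans (cong (a C r +_) (expansion-value rest)) (m+[n∸m]≡n aCr≤m)

expansion-lower : ∀ {r m L} → Expansion r m L → (2 * r ∸ 1) C r ≤ m
expansion-lower (single _ lower _ _) = lower
expansion-lower (more _ lower _ _ _ _) = lower

expansion>0 : ∀ {r m L} → Expansion r m L → 0 < m
expansion>0 (single r≥1 lower _ _) = ≤-trans (0<[2r∸1]Cr r≥1) lower
expansion>0 (more r≥1 lower _ _ _ _) = ≤-trans (0<[2r∸1]Cr r≥1) lower

head-level : ∀ {r m x k L} → Expansion r m ((x , k) ∷ L) → k ≡ r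
head-level (single _ _ _ _) = refl
head-level (more _ _ _ _ _ _) = refl

head-largestTop : ∀ {r m x k L} → Expansion r m ((x , k) ∷ L) → LargestTop r m x
head-largestTop (single _ _ top _) = top
head-largestTop (more _ _ top _ _ _) = top

head-top≥ : ∀ {t r m x k L} → t ≤ r → Expansion r m ((x , k) ∷ L) → 2 * t ∸ 1 ≤ x
head-top≥ t≤r E = ≤-trans (∸-monoˡ-≤ 1 (*-monoʳ-≤ 2 t≤r))
                          (proj₂ (head-largestTop E) _ (expansion-lower E))

expansion-rest : ∀ {r m x k L} → Expansion r m ((x , k) ∷ L) → L ≢ [] →
                 ∃[ r' ] r' < r × Expansion r' (m ∸ x C r) L
expansion-rest (single _ _ _ _) L≢[] = contradiction refl L≢[]
expansion-rest (more (s≤s z≤n) _ _ _ (r'≤r∸1 , _) rest) _ = _ , s≤s r'≤r∸1 , rest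

++-∷≢[] : ∀ {A : Set} (xs : List A) {y ys} → xs ++ y ∷ ys ≢ []
++-∷≢[] xs eq = case ++-conicalʳ xs _ eq of λ ()

level+position≤ : ∀ P {r m a ρ R} → Expansion r m (P ++ (a , ρ) ∷ R) → ρ + length P ≤ r
level+position≤ [] {ρ = ρ} E = ≤-reflexive (trans (+-identityʳ ρ) (head-level E))
level+position≤ (_ ∷ P) {ρ = ρ} E =
  let (_ , r'<r , rest) = expansion-rest E (++-∷≢[] P)
  in ≤-trans (≤-reflexive (+-suc ρ (length P))) (≤-trans (s≤s (level+position≤ P rest)) r'<r)

-- Either the next level is r-1, and Pascal's rule bounds the remainder by
-- binom(x, r-1); or it is some r' < r-1, and the maximality of r' forces y ≤ 2r'.
top-decreasing : ∀ {r m x k y k' L} → Expansion r m ((x , k) ∷ (y , k') ∷ L) → y < x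
top-decreasing {x = x} {y = y} E@(more {suc r} {r' = r'} (s≤s z≤n) _ top _ level@(r'≤r , _) rest)
  with m≤n⇒m<n∨m≡n r'≤r
... | inj₂ refl =
  nCk<n'Ck⇒n<n' r (≤-<-trans (proj₁ (head-largestTop rest)) (largestTop-remainder< r top))
... | inj₁ r'<r = <-≤-trans y<1+2r' (≤-trans (s≤s (+-mono-≤ r'≤r r'≤r)) 1+2r≤x)
  where
  y<1+2r' : y < suc (r' + r')
  y<1+2r' = nCk<n'Ck⇒n<n' r' (≤-<-trans (proj₁ (head-largestTop rest)) (largestLevel-upper level r'<r))
  1+2r≤x : suc (r + r) ≤ x
  1+2r≤x = subst (_≤ x) (2*[1+n]∸1≡1+[n+n] r) (head-top≥ ≤-refl E)

∷-expansion : ∀ {t c n σ L} → 2 * suc t ∸ 1 ≤ c → n < c C t → 0 < n →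
              LargestLevel t n σ → Expansion σ n L →
              Expansion (suc t) (value ((c , suc t) ∷ L)) ((c , suc t) ∷ L)
∷-expansion {t} {c} {n} {σ} {L} 2t+1≤c n<cCt 0<n level e =
  subst (λ v → Expansion (suc t) (c C suc t + v) ((c , suc t) ∷ L)) (sym (expansion-value e))
    (more (s≤s z≤n) lower (m≤m+n _ n , maximal)
          (subst (0 <_) (sym remainder≡n) 0<n)
          (subst (λ v → LargestLevel t v σ) (sym remainder≡n) level)
          (subst (λ v → Expansion σ v L) (sym remainder≡n) e))
  where
  remainder≡n : c C suc t + n ∸ c C suc t ≡ n
  remainder≡n = m+n∸m≡n (c C suc t) n
  lower : (2 * suc t ∸ 1) C suc t ≤ c C suc t + n
  lower = ≤-trans (C-monoˡ-≤ (suc t) 2t+1≤c) (m≤m+n _ n)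
  maximal : ∀ j → j C suc t ≤ c C suc t + n → j ≤ c
  maximal j jC≤ = ≮⇒≥ λ c<j → <⇒≱ n<cCt (+-cancelʳ-≤ (c C suc t) (c C t) n (begin
    c C t + c C suc t  ≡⟨ nCk+nC[k+1]≡[n+1]C[k+1] c t ⟩
    suc c C suc t      ≤⟨ C-monoˡ-≤ (suc t) c<j ⟩
    j C suc t          ≤⟨ jC≤ ⟩
    c C suc t + n      ≡⟨ +-comm _ n ⟩
    n + c C suc t      ∎))
    where open ≤-Reasoning

lower-head-level : ∀ {r m a k b σ Q t} → Expansion r m ((a , k) ∷ (b , σ) ∷ Q) → t ≤ k → σ < t →
                   Expansion t (value ((a , t) ∷ (b , σ) ∷ Q)) ((a , t) ∷ (b , σ) ∷ Q)
lower-head-level {t = suc t}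
  E@(more {suc r} {m} {a} {r'} (s≤s z≤n) _ _ 0<m₁ (_ , lower , maximal) rest) (s≤s t≤r) (s≤s σ≤t) =
  ∷-expansion (head-top≥ (s≤s t≤r) E) m₁<aCt 0<m₁
              (r'≤t , lower , λ j j≤t → maximal j (≤-trans j≤t t≤r)) rest
  where
  r'≤t : r' ≤ t
  r'≤t = subst (_≤ t) (head-level rest) σ≤t
  2t<a : t + t < a
  2t<a = subst (_≤ a) (2*[1+n]∸1≡1+[n+n] t) (head-top≥ (s≤s t≤r) E)
  m₁<aCt : m ∸ a C suc r < a C t
  m₁<aCt = <-≤-trans (largestTop-upper r' (head-largestTop rest))
             (≤-trans (C-monoˡ-≤ r' (top-decreasing E)) (C-monoʳ-≤ a r'≤t (m<n⇒m≤1+n 2t<a)))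

prepend-top : ∀ {r m c k a k' R t n L} → Expansion r m ((c , k) ∷ (a , k') ∷ R) → suc t ≤ r →
              Expansion t n ((a , t) ∷ L) →
              Expansion (suc t) (value ((c , suc t) ∷ (a , t) ∷ L)) ((c , suc t) ∷ (a , t) ∷ L)
prepend-top {c = c} {t = t} {n = n} E t<r F = ∷-expansion (head-top≥ t<r E) n<cCt (expansion>0 F)
                                              (≤-refl , expansion-lower F , λ _ j≤t _ → j≤t) F
  where
  n<cCt : n < c C t
  n<cCt = <-≤-trans (largestTop-upper t (head-largestTop F)) (C-monoˡ-≤ t (top-decreasing E))

prepend-relabelled : ∀ P {r m c k a ρ b σ Q t} →
  Expansion r m ((c , k) ∷ P ++ (a , ρ) ∷ (b , σ) ∷ Q) → suc t ≤ r →
  Expansion t (value (relabel t (P ++ (a , ρ) ∷ []) ++ (b , σ) ∷ Q))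
              (relabel t (P ++ (a , ρ) ∷ []) ++ (b , σ) ∷ Q) →
  Expansion (suc t) (value (relabel (suc t) ((c , k) ∷ P ++ (a , ρ) ∷ []) ++ (b , σ) ∷ Q))
                    (relabel (suc t) ((c , k) ∷ P ++ (a , ρ) ∷ []) ++ (b , σ) ∷ Q)
prepend-relabelled [] E t<r F = prepend-top E t<r F
prepend-relabelled (_ ∷ _) E t<r F = prepend-top E t<r F

relabel-expansion : ∀ P {r m a ρ b σ Q t} → Expansion r m (P ++ (a , ρ) ∷ (b , σ) ∷ Q) →
  t ≤ ρ + length P → σ + length P < t →
  Expansion t (value (relabel t (P ++ (a , ρ) ∷ []) ++ (b , σ) ∷ Q))
              (relabel t (P ++ (a , ρ) ∷ []) ++ (b , σ) ∷ Q)
relabel-expansion [] {ρ = ρ} {σ = σ} E t≤ρ σ<t =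
  lower-head-level E (subst (_ ≤_) (+-identityʳ ρ) t≤ρ) (subst (_< _) (+-identityʳ σ) σ<t)
relabel-expansion (_ ∷ P) {t = zero} E _ ()
relabel-expansion (c ∷ P) {ρ = ρ} {σ = σ} {t = suc t} E t<ρ+ℓ σ+ℓ<t =
  let (_ , _ , rest) = expansion-rest E (++-∷≢[] P)
  in prepend-relabelled P E (≤-trans t<ρ+ℓ (level+position≤ (c ∷ P) E))
       (relabel-expansion P rest
          (≤-pred (subst (suc t ≤_) (+-suc ρ (length P)) t<ρ+ℓ))
          (subst (_≤ t) (+-suc σ (length P)) (≤-pred σ+ℓ<t)))

lemma5p3 : (m r : ℕ) → 1 ≤ m → 1 ≤ r → (2 * r ∸ 1) C r ≤ m →
    (L : List Term) → Expansion r m L →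
    (t : ℕ) → 1 ≤ t → t ≤ r →
    (P Q : List Term) (a ρ b σ : ℕ) →
    L ≡ P ++ ((a , ρ) ∷ (b , σ) ∷ Q) →
    t ≤ ρ + length P →
    σ + suc (length P) < t →
    Expansion t (value (relabel t (P ++ ((a , ρ) ∷ [])) ++ ((b , σ) ∷ Q)))
    (relabel t (P ++ ((a , ρ) ∷ [])) ++ ((b , σ) ∷ Q))
lemma5p3 m r _ _ _ L E t _ _ P Q a ρ b σ refl t≤ρ+ℓ σ+ℓ+1<t =
  relabel-expansion P E t≤ρ+ℓ (<-trans (+-monoʳ-< σ (n<1+n (length P))) σ+ℓ+1<t)
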